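{- Let $\mathcal R$ be a completely defined, orthogonal constructor term rewrite system compatible with the Path Order for ETIME. If $s\in\mathcal T_{\mathsf n}$ and $s\to_{\mathcal R}t$, then $t\in\mathcal T_{\mathsf n}$.
   Context: $\mathcal F=\mathcal C\uplus\mathcal D$ is a finite signature of constructors and defined symbols; values $\mathrm{Val}$ are ground constructor terms. Argument positions of every symbol are split into normal and safe, $f(s_1,\dots,s_k;s_{k+1},\dots,s_{k+l})$; constructors have only safe arguments. A TRS is a finite set of rules $f(l_1,\dots,l_n)\to r$, $f\in\mathcal D$; completely defined orthogonal constructor means the $l_i$ contain no defined symbols, left-hand sides are linear, and each $f(v_1,\dots,v_n)$ with values $v_i$ matches exactly one rule. Rewriting is call-by-value: $f(l_1\sigma,\dots,l_n\sigma)\to r\sigma$ for a rule and $\sigma:\mathcal V\to\mathrm{Val}$, closed under contexts. $\mathcal T_{\mathsf n}$ is the least set with $\mathrm{Val}\subseteq\mathcal T_{\mathsf n}$ and $f(v_1,\dots,v_k;t_1,\dots,t_l)\in\mathcal T_{\mathsf n}$ whenever $f\in\mathcal F$, $v_1,\dots,v_k\in\mathrm{Val}$ and $t_1,\dots,t_l\in\mathcal T_{\mathsf n}$. Compatibility: for some precedence $\sqsupset$, $l>_{\mathsf{poe}}r$ for all rules, where $s=f(s_1,\dots,s_k;s_{k+1},\dots,s_{k+l})>_{\mathsf{poe}}t$ iff (1) $s_i\ge_{\mathsf{poe}}t$ for some $i$; or (2) $f\in\mathcal D$, $t=g(t_1,\dots,t_m;t_{m+1},\dots,t_{m+n})$,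 $f\sqsupset g$, each $t_j$ ($j\le m$) is a subterm of a normal argument of $s$, and $s>_{\mathsf{poe}}t_j$ for $j>m$; or (3) $f\in\mathcal D$, $t=f(t_1,\dots,t_k;t_{k+1},\dots,t_{k+l})$, $(s_1,\dots,s_k)>_{\mathsf{poe}}^{\mathrm{prod}}(t_1,\dots,t_k)$ (product extension: componentwise $\ge$, strict somewhere) and $s>_{\mathsf{poe}}t_j$ for $j>k$. -}

module Defs where

open import Data.Nat using (ℕ)
open import Data.Fin using (Fin)
open import Data.Vec using (Vec; []; _∷_; lookup; _[_]≔_)
open import Data.Vec.Relation.Unary.All using (All)
open import Data.List using (List; []; _++_)
open import Data.List.Relation.Unary.Unique.Propositional using (Unique)
open import Data.Product using (Σ; _×_)
open import Relation.Binary.PropositionalEquality using (_≡_)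
open import Relation.Binary.Structures using (IsStrictPartialOrder)

data Kind : Set where
  con def : Kind

record Signature : Set where
  field
    size : ℕ
    kind : Fin size → Kind
    nor  : Fin size → ℕ
    saf  : Fin size → ℕ
    con-no-normal : ∀ f → kind f ≡ con → nor f ≡ 0

module TRS (Sg : Signature) (V : Set) where
  open Signature Sg public

  Sym : Set
  Sym = Fin size

  -- terms f(s_1,…,s_k ; s_{k+1},…,s_{k+l}) over variables V
  data Term : Set where
    var : V → Term
    app : (f : Sym) → Vec Term (nor f) → Vec Term (saf f) → Term

  data Val : Term → Set where
    val : ∀ {c ss ts} → kind c ≡ con → All Val ss → All Val ts → Val (app c ss ts)

  data CTerm : Term → Set where
    cvar : ∀ x → CTerm (var x)
    capp : ∀ {c ss ts} → kind c ≡ con → All CTerm ss → All CTerm ts → CTerm (app c ss ts)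

  data Tn : Term → Set where
    tval : ∀ {t} → Val t → Tn t
    tapp : ∀ {f ss ts} → All Val ss → All Tn ts → Tn (app f ss ts)

  mutual
    _[_] : Term → (V → Term) → Term
    var x [ σ ] = σ x
    app f ss ts [ σ ] = app f (substV ss σ) (substV ts σ)

    substV : ∀ {n} → Vec Term n → (V → Term) → Vec Term n
    substV [] σ = []
    substV (t ∷ ts) σ = (t [ σ ]) ∷ substV ts σ

  mutual
    vars : Term → List V
    vars (var x) = x Data.List.∷ []
    vars (app f ss ts) = varsV ss ++ varsV ts

    varsV : ∀ {n} → Vec Term n → List V
    varsV [] = []
    varsV (t ∷ ts) = vars t ++ varsV ts

  record Rule : Set where
    constructor rule
    field
      head    : Sym
      headDef : kind head ≡ def
      lhsN    : Vec Term (nor head)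
      lhsS    : Vec Term (saf head)
      rhs     : Term

    lhs : Term
    lhs = app head lhsN lhsS

  open Rule public

  data _⊴_ : Term → Term → Set where
    ⊴-refl : ∀ {s} → s ⊴ s
    ⊴-n : ∀ {s f ss ts} (i : Fin (nor f)) → s ⊴ lookup ss i → s ⊴ app f ss ts
    ⊴-s : ∀ {s f ss ts} (i : Fin (saf f)) → s ⊴ lookup ts i → s ⊴ app f ss ts

  module POE (_⊐_ : Sym → Sym → Set) where
    mutual
      data _≥poe_ : Term → Term → Set where
        ≥-strict : ∀ {s t} → s >poe t → s ≥poe t
        ≥-refl   : ∀ {s} → s ≥poe s

      data _>poe_ : Term → Term → Set where
        poe1n : ∀ {f ss ts t} (i : Fin (nor f)) → lookup ss i ≥poe t → app f ss ts >poe t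
        poe1s : ∀ {f ss ts t} (i : Fin (saf f)) → lookup ts i ≥poe t → app f ss ts >poe t
        poe2 : ∀ {f ss ts g us ws} → kind f ≡ def → f ⊐ g
             → (∀ j → Σ (Fin (nor f)) λ i → lookup us j ⊴ lookup ss i)
             → (∀ j → app f ss ts >poe lookup ws j)
             → app f ss ts >poe app g us ws
        poe3 : ∀ {f ss ts us ws} → kind f ≡ def
             → (∀ i → lookup ss i ≥poe lookup us i)
             → (Σ (Fin (nor f)) λ i → lookup ss i >poe lookup us i)
             → (∀ j → app f ss ts >poe lookup ws j)
             → app f ss ts >poe app f us ws

  module Rewriting {m : ℕ} (R : Fin m → Rule) where

    Matches : Rule → Term → Set
    Matches ρ t = Σ (V → Term) λ σ → (∀ x → Val (σ x)) × (lhs ρ [ σ ] ≡ t)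

    Constructor : Set
    Constructor = ∀ i → All CTerm (lhsN (R i)) × All CTerm (lhsS (R i))

    LeftLinear : Set
    LeftLinear = ∀ i → Unique (vars (lhs (R i)))

    CompletelyDefinedOrth : Set
    CompletelyDefinedOrth =
      ∀ f → kind f ≡ def → (ss : Vec Term (nor f)) (ts : Vec Term (saf f))
        → All Val ss → All Val ts
        → Σ (Fin m) λ i → Matches (R i) (app f ss ts)
            × (∀ j → Matches (R j) (app f ss ts) → j ≡ i)

    Compatible : Set₁
    Compatible = Σ (Sym → Sym → Set) λ _⊐_ →
      IsStrictPartialOrder _≡_ _⊐_ × (∀ i → POE._>poe_ _⊐_ (lhs (R i)) (rhs (R i)))

    -- call-by-value rewrite step, closed under contexts
    data _⟶_ : Term → Term → Set where
      root : ∀ (i : Fin m) (σ : V → Term) → (∀ x → Val (σ x))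
           → (lhs (R i) [ σ ]) ⟶ (rhs (R i) [ σ ])
      ctx-n : ∀ {f ss ts u} (j : Fin (nor f)) → lookup ss j ⟶ u
            → app f ss ts ⟶ app f (ss [ j ]≔ u) ts
      ctx-s : ∀ {f ss ts u} (j : Fin (saf f)) → lookup ts j ⟶ u
            → app f ss ts ⟶ app f ss (ts [ j ]≔ u)

module Submission where

-- A term of T_n is either a value, which is irreducible because all its
-- symbols are constructors, or f(v⃗ ; t⃗) with values v⃗ and T_n-terms t⃗.
-- So a step inside a term of T_n either happens in a safe argument (handled
-- by induction on the step) or at the root.  A root step rewrites l σ to r σ
-- for a rule with l >poe r and a substitution σ by values.  The left-hand
-- side l is f(l⃗) with constructor terms l⃗, and we show by induction on the
-- derivation of f(l⃗) >poe t that t σ ∈ T_n: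
--   * case (1): t lies ≥poe below some lᵢ; the path order never leaves the
--     constructor terms, so t is a constructor term and t σ is a value;
--   * cases (2) and (3): the normal arguments of t are subterms of, or lie
--     ≥poe below, the lᵢ, hence become values under σ; the safe arguments of
--     t lie strictly below f(l⃗), hence are in T_n by induction.

open import Defs
open import Data.Nat using (ℕ)
open import Data.Fin using (Fin; zero; suc)
open import Data.Vec using (Vec; []; _∷_; lookup; _[_]≔_)
open import Data.Vec.Relation.Unary.All using (All; []; _∷_)
open import Data.Vec.Relation.Unary.All.Properties using (lookup⁺)
open import Data.Product using (proj₁; proj₂; _,_)
open import Data.Empty using (⊥; ⊥-elim)
open import Relation.Binary.PropositionalEquality using (_≡_; sym; trans)

All-[]≔ : ∀ {A : Set} {P : A → Set} {n} {xs : Vec A n} (j : Fin n) {y : A}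
  → All P xs → P y → All P (xs [ j ]≔ y)
All-[]≔ zero    (_ ∷ pxs) py = py ∷ pxs
All-[]≔ (suc j) (px ∷ pxs) py = px ∷ All-[]≔ j pxs py

con-def-disjoint : ∀ {k : Kind} → k ≡ con → k ≡ def → ⊥
con-def-disjoint k≡con k≡def with () ← trans (sym k≡con) k≡def

module Preservation (Sg : Signature) (V : Set) where
  open TRS Sg V

  All-substV : ∀ {n} (Q : Term → Set) (σ : V → Term) (us : Vec Term n)
    → (∀ j → Q (lookup us j [ σ ])) → All Q (substV us σ)
  All-substV Q σ []       q = []
  All-substV Q σ (u ∷ us) q = q zero ∷ All-substV Q σ us (λ j → q (suc j))

  module _ (σ : V → Term) (σ-val : ∀ x → Val (σ x)) where
    mutual
      CTerm-subst-Val : ∀ {u} → CTerm u → Val (u [ σ ])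
      CTerm-subst-Val (cvar x)       = σ-val x
      CTerm-subst-Val (capp c us ws) = val c (CTermV-subst-Val us) (CTermV-subst-Val ws)

      CTermV-subst-Val : ∀ {n} {us : Vec Term n} → All CTerm us → All Val (substV us σ)
      CTermV-subst-Val []       = []
      CTermV-subst-Val (u ∷ us) = CTerm-subst-Val u ∷ CTermV-subst-Val us

  ⊴-CTerm : ∀ {t u} → t ⊴ u → CTerm u → CTerm t
  ⊴-CTerm ⊴-refl       c              = c
  ⊴-CTerm (⊴-n i t⊴uᵢ) (capp _ us ws) = ⊴-CTerm t⊴uᵢ (lookup⁺ us i)
  ⊴-CTerm (⊴-s i t⊴wᵢ) (capp _ us ws) = ⊴-CTerm t⊴wᵢ (lookup⁺ ws i)

  module _ (_⊐_ : Sym → Sym → Set) where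
    open POE _⊐_

    -- Everything below a constructor term in the path order is a constructor
    -- term: only case (1) applies to a constructor-headed term.
    mutual
      ≥poe-CTerm : ∀ {u t} → CTerm u → u ≥poe t → CTerm t
      ≥poe-CTerm c (≥-strict u>t) = >poe-CTerm c u>t
      ≥poe-CTerm c ≥-refl         = c

      >poe-CTerm : ∀ {u t} → CTerm u → u >poe t → CTerm t
      >poe-CTerm (capp _ us _) (poe1n i uᵢ≥t) = ≥poe-CTerm (lookup⁺ us i) uᵢ≥t
      >poe-CTerm (capp _ _ ws) (poe1s i wᵢ≥t) = ≥poe-CTerm (lookup⁺ ws i) wᵢ≥t
      >poe-CTerm (capp c _ _)  (poe2 d _ _ _)  = ⊥-elim (con-def-disjoint c d)
      >poe-CTerm (capp c _ _)  (poe3 d _ _ _)  = ⊥-elim (con-def-disjoint c d)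

    below-constructor-lhs-Tn : (σ : V → Term) → (∀ x → Val (σ x))
      → ∀ {f ls ls' t} → All CTerm ls → All CTerm ls' → app f ls ls' >poe t → Tn (t [ σ ])
    below-constructor-lhs-Tn σ σ-val ls ls' (poe1n i lᵢ≥t) =
      tval (CTerm-subst-Val σ σ-val (≥poe-CTerm (lookup⁺ ls i) lᵢ≥t))
    below-constructor-lhs-Tn σ σ-val ls ls' (poe1s i lᵢ≥t) =
      tval (CTerm-subst-Val σ σ-val (≥poe-CTerm (lookup⁺ ls' i) lᵢ≥t))
    below-constructor-lhs-Tn σ σ-val ls ls' (poe2 {us = us} {ws = ws} _ _ normal⊴ safe<) =
      tapp (All-substV Val σ us normal-val) (All-substV Tn σ ws safe-Tn)
      where
      normal-val : ∀ j → Val (lookup us j [ σ ])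
      normal-val j with normal⊴ j
      ... | i , uⱼ⊴lᵢ = CTerm-subst-Val σ σ-val (⊴-CTerm uⱼ⊴lᵢ (lookup⁺ ls i))
      safe-Tn : ∀ j → Tn (lookup ws j [ σ ])
      safe-Tn j = below-constructor-lhs-Tn σ σ-val ls ls' (safe< j)
    below-constructor-lhs-Tn σ σ-val ls ls' (poe3 {us = us} {ws = ws} _ normal≥ _ safe<) =
      tapp (All-substV Val σ us normal-val) (All-substV Tn σ ws safe-Tn)
      where
      normal-val : ∀ i → Val (lookup us i [ σ ])
      normal-val i = CTerm-subst-Val σ σ-val (≥poe-CTerm (lookup⁺ ls i) (normal≥ i))
      safe-Tn : ∀ j → Tn (lookup ws j [ σ ])
      safe-Tn j = below-constructor-lhs-Tn σ σ-val ls ls' (safe< j)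

  module _ {m : ℕ} (R : Fin m → Rule) where
    open Rewriting R

    -- Values are normal forms: a rule's head is defined, values contain none.
    Val-irreducible : ∀ {s t} → Val s → s ⟶ t → ⊥
    Val-irreducible (val c _ _)  (root i _ _)   = con-def-disjoint c (headDef (R i))
    Val-irreducible (val _ us _) (ctx-n j step) = Val-irreducible (lookup⁺ us j) step
    Val-irreducible (val _ _ ws) (ctx-s j step) = Val-irreducible (lookup⁺ ws j) step

    ⟶-preserves-Tn : Constructor → Compatible → ∀ {s t} → Tn s → s ⟶ t → Tn t
    ⟶-preserves-Tn constr (_⊐_ , _ , compat) _ (root i σ σ-val) =
      below-constructor-lhs-Tn _⊐_ σ σ-val (proj₁ (constr i)) (proj₂ (constr i)) (compat i)
    ⟶-preserves-Tn _ _ (tval v) step = ⊥-elim (Val-irreducible v step)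
    ⟶-preserves-Tn _ _ (tapp vs _) (ctx-n j step) = ⊥-elim (Val-irreducible (lookup⁺ vs j) step)
    ⟶-preserves-Tn constr compat (tapp vs ts) (ctx-s j step) =
      tapp vs (All-[]≔ j ts (⟶-preserves-Tn constr compat (lookup⁺ ts j) step))

open TRS using (Tn; Rule; module Rewriting)
open Rewriting using (Constructor; LeftLinear; CompletelyDefinedOrth; Compatible; _⟶_)

lemma5 : (Sg : Signature) (V : Set) (m : ℕ) (R : Fin m → Rule Sg V)
    → Constructor Sg V R → LeftLinear Sg V R
    → CompletelyDefinedOrth Sg V R → Compatible Sg V R
    → ∀ {s t} → Tn Sg V s → _⟶_ Sg V R s t → Tn Sg V t
lemma5 Sg V m R constr _ _ compat = Preservation.⟶-preserves-Tn Sg V R constr compat
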